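{- Let $G=(V,E)$ be a directed acyclic graph with exactly one source (vertex of in-degree $0$) and exactly one sink (vertex of out-degree $0$), and $n=|V|$. Let $\textit{ordD}$ and $T$ be the topological ordering and the directed rooted spanning tree of $G$ obtained by the procedure TopologicalSort described in the context (for any choice of the order in which out-neighbours are scanned). If there is a path in $T$ from a vertex $v$ to a vertex $u$, then for every vertex $w$ with $\textit{ordD}[v]<\textit{ordD}[w]<\textit{ordD}[u]$ there is a path in $G$ from $v$ to $w$.
   Context: Procedure TopologicalSort on $G$: set a counter $\textit{order}:=n$, mark all vertices unvisited, and call Visit(source), where Visit($v$) does: mark $v$ visited; for each out-neighbour $w$ of $v$ (in some order), if $w$ is unvisited, call Visit($w$); then set $\textit{ordD}[v]:=\textit{order}$ and decrease $\textit{order}$ by $1$. The tree $T$ consists of all edges $(v,w)$ such that Visit($w$) was called from within Visit($v$); it is a spanning tree of $G$ rooted at the source, with all edges directed away from the root. The map $\textit{ordD}:V\to\{1,\dots,n\}$ is a topological ordering, i.e. $\textit{ordD}[x]<\textit{ordD}[y]$ for every edge $(x,y)\in E$. -}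

module Defs where

open import Data.Nat using (ℕ; zero; suc; _∸_)
open import Data.Fin using (Fin; _≟_)
open import Data.Bool using (Bool; true; false; if_then_else_)
open import Data.List using (List; []; _∷_)
open import Data.List.Membership.Propositional using (_∈_)
open import Data.Product using (_×_; _,_)
open import Relation.Nullary using (¬_)
open import Relation.Nullary.Decidable using (⌊_⌋)
open import Relation.Binary.PropositionalEquality using (_≡_)
open import Relation.Binary.Construct.Closure.Transitive using (TransClosure)

-- A directed graph on vertex set Fin n, given by out-neighbour lists.
-- The order of each list is the order in which Visit scans out-neighbours.
Adj : ℕ → Set
Adj n = Fin n → List (Fin n)

Edge : ∀ {n} → Adj n → Fin n → Fin n → Set
Edge adj x y = y ∈ adj x

Acyclic : ∀ {n} → Adj n → Set
Acyclic {n} adj = ∀ (v : Fin n) → ¬ TransClosure (Edge adj) v v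

IsSource : ∀ {n} → Adj n → Fin n → Set
IsSource {n} adj v = ∀ (u : Fin n) → ¬ Edge adj u v

IsSink : ∀ {n} → Adj n → Fin n → Set
IsSink {n} adj v = ∀ (w : Fin n) → ¬ Edge adj v w

update : ∀ {n} {A : Set} → (Fin n → A) → Fin n → A → Fin n → A
update f i x j = if ⌊ j ≟ i ⌋ then x else f j

record State (n : ℕ) : Set where
  constructor st
  field
    visited : Fin n → Bool
    order   : ℕ
    ordD    : Fin n → ℕ
    tree    : List (Fin n × Fin n)
open State public

markVisited : ∀ {n} → Fin n → State n → State n
markVisited v (st vis o od t) = st (update vis v true) o od t

finish : ∀ {n} → Fin n → State n → State n
finish v (st vis o od t) = st vis (o ∸ 1) (update od v o) t

addTreeEdge : ∀ {n} → Fin n → Fin n → State n → State n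
addTreeEdge v w (st vis o od t) = st vis o od ((v , w) ∷ t)

-- Big-step semantics of the recursive procedure.
-- Visit adj v s s'   : calling Visit(v) in state s terminates in state s'.
-- Scan adj v ws s s' : the loop of Visit(v) over the remaining out-neighbours ws.
mutual
  data Visit {n} (adj : Adj n) : Fin n → State n → State n → Set where
    visit : ∀ {v s s'} →
            Scan adj v (adj v) (markVisited v s) s' →
            Visit adj v s (finish v s')

  data Scan {n} (adj : Adj n) (v : Fin n) : List (Fin n) → State n → State n → Set where
    done    : ∀ {s} → Scan adj v [] s s
    skip    : ∀ {w ws s s'} → visited s w ≡ true →
              Scan adj v ws s s' → Scan adj v (w ∷ ws) s s'
    descend : ∀ {w ws s s₁ s₂} → visited s w ≡ false →
              Visit adj w (addTreeEdge v w s) s₁ →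
              Scan adj v ws s₁ s₂ → Scan adj v (w ∷ ws) s s₂

-- Initial state: all unvisited, order := n, ordD not yet set (0), T empty.
initial : (n : ℕ) → State n
initial n = st (λ _ → false) n (λ _ → 0) []

-- TopologicalSort adj src fin : running TopologicalSort on (adj, src)
-- terminates in the final state fin (ordD = ordD fin, T = tree fin).
TopologicalSort : ∀ {n} → Adj n → Fin n → State n → Set
TopologicalSort {n} adj src fin = Visit adj src (initial n) fin

TreeEdge : ∀ {n} → State n → Fin n → Fin n → Set
TreeEdge s x y = (x , y) ∈ tree s

-- Let x be finished (ordD x > 0) with tree child y.  Visit(y) was called from Visit(x)
-- and ordD decreases over time, so every w with ordD x < ordD w ≤ ordD y was finished
-- during Visit(x), hence first visited during it, and is therefore reachable from x.
-- Along a tree path v → v' → … → u, a vertex w with ordD v < ordD w < ordD u either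
-- satisfies ordD w ≤ ordD v', or is reachable from v' by induction.
module Submission where

open import Defs
open import Data.Nat using (ℕ; _<_; _≤_; _+_; _∸_; suc; z≤n; s≤s; _<?_)
open import Data.Nat.Properties
  using (≤-refl; ≤-trans; <-trans; <-≤-trans; ≤-<-trans; <-irrefl; <-asym; <⇒≱; ≮⇒≥; ≰⇒>; _≤?_;
         n≤0⇒n≡0; m≤m+n; m∸n≤m; ∸-monoʳ-<; m∸n+n≡m; +-assoc; +-monoʳ-≤; +-cancelʳ-<;
         module ≤-Reasoning)
open import Data.Fin using (Fin; _≟_)
open import Data.Fin.Subset as Subset using (Subset; ∣_∣)
open import Data.Fin.Subset.Properties using (p⊂q⇒∣p∣<∣q∣; ∣⊤∣≡n; ∈⊤)
open import Data.Vec using (tabulate)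
open import Data.Vec.Properties using (lookup∘tabulate; lookup⇒[]=; []=⇒lookup)
open import Data.Bool using (true; false)
open import Data.List.Membership.Propositional using (_∈_)
open import Data.List.Relation.Binary.Subset.Propositional using (_⊆_)
open import Data.List.Relation.Unary.Any using (here; there)
open import Data.Product using (_×_; _,_)
open import Data.Sum using (_⊎_; inj₁; inj₂)
open import Data.Empty using (⊥-elim)
open import Function using (id; _∘_)
open import Relation.Nullary using (¬_; yes; no; does)
open import Relation.Nullary.Decidable using (dec-true; dec-false)
open import Relation.Binary.PropositionalEquality
  using (_≡_; _≢_; refl; sym; trans; cong; subst; subst₂)
open import Relation.Binary.Construct.Closure.ReflexiveTransitive using (Star; ε; _◅_)

update-≡ : ∀ {n} {A : Set} (f : Fin n → A) i a → update f i a i ≡ a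
update-≡ f i a with i ≟ i
... | yes _ = refl
... | no i≢i = ⊥-elim (i≢i refl)

update-≢ : ∀ {n} {A : Set} (f : Fin n → A) {i j} a → j ≢ i → update f i a j ≡ f j
update-≢ f {i} {j} a j≢i with j ≟ i
... | yes j≡i = ⊥-elim (j≢i j≡i)
... | no _ = refl

markVisited-mono : ∀ {n} (v : Fin n) s x → visited s x ≡ true → visited (markVisited v s) x ≡ true
markVisited-mono v s x visited-x with x ≟ v
... | yes _ = refl
... | no _ = visited-x

positives : ∀ {n} → (Fin n → ℕ) → Subset n
positives f = tabulate (λ x → does (0 <? f x))

∈-positives⁺ : ∀ {n} (f : Fin n → ℕ) {x} → 0 < f x → x Subset.∈ positives f
∈-positives⁺ f {x} fx>0 = lookup⇒[]= x _ (trans (lookup∘tabulate _ x) (dec-true (0 <? f x) fx>0))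

∈-positives⁻ : ∀ {n} (f : Fin n → ℕ) {x} → x Subset.∈ positives f → 0 < f x
∈-positives⁻ f {x} x∈ with 0 <? f x
... | yes fx>0 = fx>0
... | no fx≯0 with () ← trans (sym (dec-false (0 <? f x) fx≯0))
                             (trans (sym (lookup∘tabulate _ x)) ([]=⇒lookup x∈))

∉-positives : ∀ {n} (f : Fin n → ℕ) {v} → f v ≡ 0 → ¬ v Subset.∈ positives f
∉-positives f fv≡0 v∈ = <-irrefl (sym fv≡0) (∈-positives⁻ f v∈)

∣positives∣<n : ∀ {n} (f : Fin n → ℕ) {v} → f v ≡ 0 → ∣ positives f ∣ < n
∣positives∣<n {n} f {v} fv≡0 = subst (∣ positives f ∣ <_) (∣⊤∣≡n n)
  (p⊂q⇒∣p∣<∣q∣ ((λ _ → ∈⊤) , v , ∈⊤ , ∉-positives f fv≡0))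

positives-update : ∀ {n} (f : Fin n → ℕ) {v k} → f v ≡ 0 → 0 < k →
                   ∣ positives f ∣ < ∣ positives (update f v k) ∣
positives-update f {v} {k} fv≡0 k>0 = p⊂q⇒∣p∣<∣q∣ (grows , v , ∈-positives⁺ (update f v k) v-new , ∉-positives f fv≡0)
  where
  v-new : 0 < update f v k v
  v-new = subst (0 <_) (sym (update-≡ f v k)) k>0
  grows : ∀ {x} → x Subset.∈ positives f → x Subset.∈ positives (update f v k)
  grows {x} x∈ with x ≟ v
  ... | yes refl = ∈-positives⁺ (update f v k) v-new
  ... | no x≢v = ∈-positives⁺ (update f v k) (subst (0 <_) (sym (update-≢ f k x≢v)) (∈-positives⁻ f x∈))

module _ {n : ℕ} (adj : Adj n) where

  -- ordD s x ≡ 0 encodes that x is not finished yet.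
  record Invariant (s : State n) : Set where
    field
      finished⇒visited : ∀ x → 0 < ordD s x → visited s x ≡ true
      order<finished : ∀ x → 0 < ordD s x → order s < ordD s x
      n≤order+finished : n ≤ order s + ∣ positives (ordD s) ∣
      tree-source-visited : ∀ {x y} → (x , y) ∈ tree s → visited s x ≡ true
      tree⊆edges : ∀ {x y} → (x , y) ∈ tree s → Edge adj x y
      tree-window-reachable : ∀ {x y} → (x , y) ∈ tree s → 0 < ordD s x →
        ∀ w → ordD s x < ordD s w → ordD s w ≤ ordD s y → Star (Edge adj) x w

  open Invariant

  unvisited⇒unfinished : ∀ {s} → Invariant s → ∀ {x} → visited s x ≡ false → ordD s x ≡ 0
  unvisited⇒unfinished {s} I {x} unvisited with 0 <? ordD s x
  ... | yes finished with () ← trans (sym unvisited) (finished⇒visited I x finished)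
  ... | no unfinished = n≤0⇒n≡0 (≮⇒≥ unfinished)

  -- An unfinished vertex leaves fewer than n finished ones.
  order-positive : ∀ {s} → Invariant s → ∀ {v} → ordD s v ≡ 0 → 0 < order s
  order-positive {s} I v-unfinished = +-cancelʳ-< ∣ positives (ordD s) ∣ 0 (order s)
    (<-≤-trans (∣positives∣<n (ordD s) v-unfinished) (n≤order+finished I))

  initial-invariant : Invariant (initial n)
  initial-invariant = record
    { finished⇒visited = λ _ ()
    ; order<finished = λ _ ()
    ; n≤order+finished = m≤m+n n _
    ; tree-source-visited = λ ()
    ; tree⊆edges = λ ()
    ; tree-window-reachable = λ ()
    }

  markVisited-invariant : ∀ {s} v → Invariant s → Invariant (markVisited v s)
  markVisited-invariant {s} v I = record
    { finished⇒visited = λ x → markVisited-mono v s x ∘ finished⇒visited I x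
    ; order<finished = order<finished I
    ; n≤order+finished = n≤order+finished I
    ; tree-source-visited = λ {x} → markVisited-mono v s x ∘ tree-source-visited I
    ; tree⊆edges = tree⊆edges I
    ; tree-window-reachable = tree-window-reachable I
    }

  Fresh Stale : State n → State n → Fin n → Set
  Fresh s s' x = visited s x ≡ false × visited s' x ≡ true
  Stale s s' x = visited s x ≡ true ⊎ visited s' x ≡ false

  no-fresh : ∀ s {x} → ¬ Fresh s s x
  no-fresh _ (unvisited , visited) with () ← trans (sym unvisited) visited

  fresh-or-stale : ∀ s s' x → Fresh s s' x ⊎ Stale s s' x
  fresh-or-stale s s' x with visited s x | visited s' x
  ... | true | _ = inj₂ (inj₁ refl)
  ... | false | true = inj₁ (refl , refl)
  ... | false | false = inj₂ (inj₂ refl)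

  -- The effect of a call Visit(r), or of the remainder of its scan, from state s to s'.
  record Run (r : Fin n) (s s' : State n) : Set where
    field
      invariant : Invariant s'
      order-mono : order s' ≤ order s
      visited-mono : ∀ x → visited s x ≡ true → visited s' x ≡ true
      fresh-window : ∀ {x} → Fresh s s' x → order s' < ordD s' x × ordD s' x ≤ order s
      fresh-reachable : ∀ {x} → Fresh s s' x → Star (Edge adj) r x
      stale-ordD : ∀ {x} → Stale s s' x → ordD s' x ≡ ordD s x
      new-tree-edge : ∀ {x y} → (x , y) ∈ tree s' → (x , y) ∈ tree s ⊎ ordD s' y ≤ order s

  open Run

  module _ {r s s'} (R : Run r s s') where

    visited-antimono : ∀ x → visited s' x ≡ false → visited s x ≡ false
    visited-antimono x unvisited' with visited s x in eq
    ... | false = refl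
    ... | true with () ← trans (sym (visited-mono R x eq)) unvisited'

    ordD-bounded : ∀ {y b} → ordD s y ≤ b → order s ≤ b → ordD s' y ≤ b
    ordD-bounded {y} y≤b order≤b with fresh-or-stale s s' y
    ... | inj₁ fresh with _ , y≤order ← fresh-window R fresh = ≤-trans y≤order order≤b
    ... | inj₂ stale = subst (_≤ _) (sym (stale-ordD R stale)) y≤b

    -- A stale vertex above order s' was finished before the run, hence lies above order s.
    window-reachable : Invariant s → ∀ w → order s' < ordD s' w → ordD s' w ≤ order s →
                       Star (Edge adj) r w
    window-reachable I w above below with fresh-or-stale s s' w
    ... | inj₁ fresh = fresh-reachable R fresh
    ... | inj₂ stale = ⊥-elim (<⇒≱ order<w (subst (_≤ order s) w-same below))
      where
      w-same : ordD s' w ≡ ordD s w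
      w-same = stale-ordD R stale
      order<w : order s < ordD s w
      order<w = order<finished I w (≤-<-trans z≤n (subst (order s' <_) w-same above))

  Run-refl : ∀ {r s} → Invariant s → Run r s s
  Run-refl {s = s} I = record
    { invariant = I
    ; order-mono = ≤-refl
    ; visited-mono = λ _ → id
    ; fresh-window = ⊥-elim ∘ no-fresh s
    ; fresh-reachable = ⊥-elim ∘ no-fresh s
    ; stale-ordD = λ _ → refl
    ; new-tree-edge = inj₁
    }

  Run-trans : ∀ {r s s₁ s₂} → Run r s s₁ → Run r s₁ s₂ → Run r s s₂
  Run-trans {r} {s} {s₁} {s₂} R₁ R₂ = record
    { invariant = invariant R₂
    ; order-mono = ≤-trans (order-mono R₂) (order-mono R₁)
    ; visited-mono = λ x → visited-mono R₂ x ∘ visited-mono R₁ x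
    ; fresh-window = window
    ; fresh-reachable = reachable
    ; stale-ordD = stale
    ; new-tree-edge = new-edge
    }
    where
    window : ∀ {x} → Fresh s s₂ x → order s₂ < ordD s₂ x × ordD s₂ x ≤ order s
    window {x} (unvisited , visited₂) with fresh-or-stale s s₁ x
    ... | inj₁ fresh₁@(_ , visited₁) with above , below ← fresh-window R₁ fresh₁ =
      subst (order s₂ <_) same (≤-<-trans (order-mono R₂) above) , subst (_≤ order s) same below
      where
      same : ordD s₁ x ≡ ordD s₂ x
      same = sym (stale-ordD R₂ (inj₁ visited₁))
    ... | inj₂ (inj₁ visited) with () ← trans (sym unvisited) visited
    ... | inj₂ (inj₂ unvisited₁) with above , below ← fresh-window R₂ (unvisited₁ , visited₂) =
      above , ≤-trans below (order-mono R₁)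
    reachable : ∀ {x} → Fresh s s₂ x → Star (Edge adj) r x
    reachable {x} (unvisited , visited₂) with fresh-or-stale s s₁ x
    ... | inj₁ fresh₁ = fresh-reachable R₁ fresh₁
    ... | inj₂ (inj₁ visited) with () ← trans (sym unvisited) visited
    ... | inj₂ (inj₂ unvisited₁) = fresh-reachable R₂ (unvisited₁ , visited₂)
    stale : ∀ {x} → Stale s s₂ x → ordD s₂ x ≡ ordD s x
    stale {x} (inj₁ visited) =
      trans (stale-ordD R₂ (inj₁ (visited-mono R₁ x visited))) (stale-ordD R₁ (inj₁ visited))
    stale {x} (inj₂ unvisited₂) =
      trans (stale-ordD R₂ (inj₂ unvisited₂)) (stale-ordD R₁ (inj₂ (visited-antimono R₂ x unvisited₂)))
    new-edge : ∀ {x y} → (x , y) ∈ tree s₂ → (x , y) ∈ tree s ⊎ ordD s₂ y ≤ order s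
    new-edge e with new-tree-edge R₂ e
    ... | inj₂ y≤order₁ = inj₂ (≤-trans y≤order₁ (order-mono R₁))
    ... | inj₁ e₁ with new-tree-edge R₁ e₁
    ...   | inj₁ e₀ = inj₁ e₀
    ...   | inj₂ y≤order = inj₂ (ordD-bounded R₂ y≤order (order-mono R₁))

  Run-prefix : ∀ {r r' s s'} → Edge adj r r' → Run r' s s' → Run r s s'
  Run-prefix e R = record
    { invariant = invariant R
    ; order-mono = order-mono R
    ; visited-mono = visited-mono R
    ; fresh-window = fresh-window R
    ; fresh-reachable = λ fresh → e ◅ fresh-reachable R fresh
    ; stale-ordD = stale-ordD R
    ; new-tree-edge = new-tree-edge R
    }

  Run-addTreeEdge : ∀ {s v w} → Invariant s → visited s v ≡ true → ordD s v ≡ 0 →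
                    Edge adj v w → visited s w ≡ false → Run v s (addTreeEdge v w s)
  Run-addTreeEdge {s} {v} {w} I visited-v unfinished-v e unvisited-w = record
    { invariant = record
      { finished⇒visited = finished⇒visited I
      ; order<finished = order<finished I
      ; n≤order+finished = n≤order+finished I
      ; tree-source-visited = λ { (here refl) → visited-v ; (there e') → tree-source-visited I e' }
      ; tree⊆edges = λ { (here refl) → e ; (there e') → tree⊆edges I e' }
      ; tree-window-reachable = λ
          { (here refl) v-finished → ⊥-elim (<-irrefl (sym unfinished-v) v-finished)
          ; (there e') → tree-window-reachable I e' }
      }
    ; order-mono = ≤-refl
    ; visited-mono = λ _ → id
    ; fresh-window = ⊥-elim ∘ no-fresh s
    ; fresh-reachable = ⊥-elim ∘ no-fresh s
    ; stale-ordD = λ _ → refl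
    ; new-tree-edge = λ
        { (here refl) → inj₂ (subst (_≤ order s) (sym (unvisited⇒unfinished I unvisited-w)) z≤n)
        ; (there e') → inj₁ e' }
    }

  module Finishing {s s' v} (I : Invariant s) (unvisited : visited s v ≡ false)
                   (R : Run v (markVisited v s) s') where

    o' : ℕ
    o' = order s'
    d' D : Fin n → ℕ
    d' = ordD s'
    D = ordD (finish v s')
    I' : Invariant s'
    I' = invariant R

    v-visited' : visited s' v ≡ true
    v-visited' = visited-mono R v (update-≡ (visited s) v true)
    v-unfinished' : d' v ≡ 0
    v-unfinished' = trans (stale-ordD R (inj₁ (update-≡ (visited s) v true))) (unvisited⇒unfinished I unvisited)
    o'>0 : 0 < o'
    o'>0 = order-positive I' v-unfinished'
    o'∸1<o' : o' ∸ 1 < o'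
    o'∸1<o' = ∸-monoʳ-< (s≤s z≤n) o'>0
    above⇒unchanged : ∀ x → o' < D x → D x ≡ d' x
    above⇒unchanged x above with x ≟ v
    ... | yes refl = ⊥-elim (<-irrefl refl above)
    ... | no _ = refl
    unmarked : ∀ {x} → x ≢ v → visited (markVisited v s) x ≡ visited s x
    unmarked x≢v = update-≢ (visited s) true x≢v

    window : ∀ {x} → Fresh s (finish v s') x → o' ∸ 1 < D x × D x ≤ order s
    window {x} (unvisited-x , visited-x) with x ≟ v
    ... | yes refl = o'∸1<o' , order-mono R
    ... | no x≢v with above , below ← fresh-window R (trans (unmarked x≢v) unvisited-x , visited-x) =
      ≤-<-trans (m∸n≤m o' 1) above , below

    reachable : ∀ {x} → Fresh s (finish v s') x → Star (Edge adj) v x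
    reachable {x} (unvisited-x , visited-x) with x ≟ v
    ... | yes refl = ε
    ... | no x≢v = fresh-reachable R (trans (unmarked x≢v) unvisited-x , visited-x)

    stale : ∀ {x} → Stale s (finish v s') x → D x ≡ ordD s x
    stale {x} stale-x with x ≟ v
    stale (inj₁ visited-v) | yes refl with () ← trans (sym unvisited) visited-v
    stale (inj₂ unvisited-v) | yes refl with () ← trans (sym v-visited') unvisited-v
    stale {x} (inj₁ visited-x) | no _ = stale-ordD R (inj₁ (markVisited-mono v s x visited-x))
    stale (inj₂ unvisited-x) | no _ = stale-ordD R (inj₂ unvisited-x)

    new-edge : ∀ {x y} → (x , y) ∈ tree s' → (x , y) ∈ tree s ⊎ D y ≤ order s
    new-edge {y = y} e with new-tree-edge R e
    ... | inj₁ e₀ = inj₁ e₀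
    ... | inj₂ y≤order with y ≟ v
    ...   | yes refl = inj₂ (order-mono R)
    ...   | no _ = inj₂ y≤order

    -- A tree edge out of v was added during the scan of v, so its child lies in the
    -- window of R; tree edges out of other vertices are unaffected by finishing v.
    tree-window : ∀ {x y} → (x , y) ∈ tree s' → 0 < D x →
                  ∀ w → D x < D w → D w ≤ D y → Star (Edge adj) x w
    tree-window {x} {y} e x-finished w x<w w≤y with x ≟ v
    ... | yes refl with new-edge e
    ...   | inj₁ e₀ with () ← trans (sym unvisited) (tree-source-visited I e₀)
    ...   | inj₂ y≤order =
      window-reachable R (markVisited-invariant v I) w (subst (o' <_) w-same x<w)
        (subst (_≤ order s) w-same (≤-trans w≤y y≤order))
      where
      w-same : D w ≡ d' w
      w-same = above⇒unchanged w x<w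
    tree-window {x} {y} e x-finished w x<w w≤y | no _ =
      tree-window-reachable I' e x-finished w (subst (d' x <_) w-same x<w) (subst₂ _≤_ w-same y-same w≤y)
      where
      o'<w : o' < D w
      o'<w = <-trans (order<finished I' x x-finished) x<w
      w-same : D w ≡ d' w
      w-same = above⇒unchanged w o'<w
      y-same : D y ≡ d' y
      y-same = above⇒unchanged y (<-≤-trans o'<w w≤y)

    finished⇒visited′ : ∀ x → 0 < D x → visited s' x ≡ true
    finished⇒visited′ x x-finished with x ≟ v
    ... | yes refl = v-visited'
    ... | no _ = finished⇒visited I' x x-finished

    order<finished′ : ∀ x → 0 < D x → o' ∸ 1 < D x
    order<finished′ x x-finished with x ≟ v
    ... | yes refl = o'∸1<o'
    ... | no _ = ≤-<-trans (m∸n≤m o' 1) (order<finished I' x x-finished)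

    n≤order+finished′ : n ≤ o' ∸ 1 + ∣ positives D ∣
    n≤order+finished′ = begin
      n                                  ≤⟨ n≤order+finished I' ⟩
      o' + ∣ positives d' ∣              ≡⟨ cong (_+ ∣ positives d' ∣) (sym (m∸n+n≡m o'>0)) ⟩
      o' ∸ 1 + 1 + ∣ positives d' ∣      ≡⟨ +-assoc (o' ∸ 1) 1 _ ⟩
      o' ∸ 1 + suc ∣ positives d' ∣      ≤⟨ +-monoʳ-≤ (o' ∸ 1) (positives-update d' v-unfinished' o'>0) ⟩
      o' ∸ 1 + ∣ positives D ∣           ∎
      where open ≤-Reasoning

    finish-invariant : Invariant (finish v s')
    finish-invariant = record
      { finished⇒visited = finished⇒visited′
      ; order<finished = order<finished′
      ; n≤order+finished = n≤order+finished′
      ; tree-source-visited = tree-source-visited I'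
      ; tree⊆edges = tree⊆edges I'
      ; tree-window-reachable = tree-window
      }

  Run-finish : ∀ {s s' v} → Invariant s → visited s v ≡ false →
               Run v (markVisited v s) s' → Run v s (finish v s')
  Run-finish {s} {v = v} I unvisited R = record
    { invariant = finish-invariant
    ; order-mono = ≤-trans (m∸n≤m o' 1) (order-mono R)
    ; visited-mono = λ x → visited-mono R x ∘ markVisited-mono v s x
    ; fresh-window = window
    ; fresh-reachable = reachable
    ; stale-ordD = stale
    ; new-tree-edge = new-edge
    }
    where open Finishing I unvisited R

  mutual
    visit-run : ∀ {v s s'} → Visit adj v s s' → Invariant s → visited s v ≡ false → Run v s s'
    visit-run {v} {s} (visit scan) I unvisited = Run-finish I unvisited
      (scan-run scan id (markVisited-invariant v I) (update-≡ (visited s) v true)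
        (unvisited⇒unfinished I unvisited))

    scan-run : ∀ {v ws s s'} → Scan adj v ws s s' → ws ⊆ adj v → Invariant s →
               visited s v ≡ true → ordD s v ≡ 0 → Run v s s'
    scan-run done _ I _ _ = Run-refl I
    scan-run (skip _ scan) ws⊆ I visited-v unfinished-v = scan-run scan (ws⊆ ∘ there) I visited-v unfinished-v
    scan-run {v} {s = s} (descend {w} {s₁ = s₁} {s₂ = s₂} unvisited-w call scan) ws⊆ I visited-v unfinished-v =
      Run-trans (Run-trans R₀ (Run-prefix e R₁)) R₂
      where
      e : Edge adj v w
      e = ws⊆ (here refl)
      R₀ : Run v s (addTreeEdge v w s)
      R₀ = Run-addTreeEdge I visited-v unfinished-v e unvisited-w
      R₁ : Run w (addTreeEdge v w s) s₁
      R₁ = visit-run call (invariant R₀) unvisited-w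
      R₂ : Run v s₁ s₂
      R₂ = scan-run scan (ws⊆ ∘ there) (invariant R₁) (visited-mono R₁ v visited-v)
             (trans (stale-ordD R₁ (inj₁ visited-v)) unfinished-v)

  tree-path-window-reachable : ∀ {s} → Invariant s → (∀ x → visited s x ≡ true → 0 < ordD s x) →
    ∀ {v u} → Star (TreeEdge s) v u →
    ∀ w → ordD s v < ordD s w → ordD s w < ordD s u → Star (Edge adj) v w
  tree-path-window-reachable I complete ε w v<w w<u = ⊥-elim (<-asym v<w w<u)
  tree-path-window-reachable {s} I complete {v} (_◅_ {j = v'} e path) w v<w w<u with ordD s w ≤? ordD s v'
  ... | yes w≤v' = tree-window-reachable I e (complete v (tree-source-visited I e)) w v<w w≤v'
  ... | no w≰v' = tree⊆edges I e ◅ tree-path-window-reachable I complete path w (≰⇒> w≰v') w<u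

proposition2 : (n : ℕ) (adj : Adj n) →
    Acyclic adj →
    (src : Fin n) → IsSource adj src → (∀ v → IsSource adj v → v ≡ src) →
    (snk : Fin n) → IsSink adj snk → (∀ v → IsSink adj v → v ≡ snk) →
    (fin : State n) → TopologicalSort adj src fin →
    (v u : Fin n) → Star (TreeEdge fin) v u →
    (w : Fin n) → ordD fin v < ordD fin w → ordD fin w < ordD fin u →
    Star (Edge adj) v w
proposition2 n adj _ src _ _ _ _ _ fin sort v u path =
  tree-path-window-reachable adj (Run.invariant run) complete path
  where
  run : Run adj src (initial n) fin
  run = visit-run adj sort (initial-invariant adj) refl
  complete : ∀ x → visited fin x ≡ true → 0 < ordD fin x
  complete x visited-x with above , _ ← Run.fresh-window run (refl , visited-x) = ≤-<-trans z≤n above
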